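{- Let $\phi$ be a stratified formula and $s$ a stratified term, let $i=\mathrm{level}(s)$ and $a\in\mathbb{A}_i$ (so that $s\in\{a\mid\phi\}$ is stratified). Then (1) $[\![s\in\{a\mid\phi\}]\!]=[\![\phi[a:=s]]\!]$, and (2) $[\![s\in\{a\mid\phi\}]\!]=[\![\phi]\!][a\mapsto[\![s]\!]]$.
   Context: Atoms: for each $i\in\mathbb{Z}$ fix a countably infinite set $\mathbb{A}_i$ of atoms, pairwise disjoint, $\mathbb{A}=\bigcup_i\mathbb{A}_i$, $\mathrm{level}(a)=i$ iff $a\in\mathbb{A}_i$. Permutations are finitely-supported level-preserving bijections of $\mathbb{A}$; $\mathrm{supp}(x)$ is the least finite set of atoms such that every permutation fixing it pointwise fixes $x$, and $a\#x$ means $a\notin\mathrm{supp}(x)$. $[a]X$ is nominal atoms-abstraction (binding $a$ in $X$): $[a]X=[b]((b\ a)\cdot X)$ when $b\#X$. Internal syntax: $\mathsf{Pred}$ and $\mathsf{Set}_i$ ($i\in\mathbb{Z}$) are defined inductively: $\mathsf{atm}(a)\in\mathsf{Set}_i$ for $a\in\mathbb{A}_i$; $\mathsf{and}(\mathcal X)\in\mathsf{Pred}$ for finite $\mathcal X\subseteq\mathsf{Pred}$; $\mathsf{neg}(X)$; $\mathsf{all}([a]X)$ for $a\in\mathbb{A}$; $\mathsf{elt}(x,a)\in\mathsf{Pred}$ for $a\in\mathbb{A}_{i+1}$, $x\in\mathsf{Set}_i$; $\mathsf{st}([a]X)\in\mathsf{Set}_i$ for $a\in\mathbb{A}_{i-1}$,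 $X\in\mathsf{Pred}$ (an internal comprehension). For an internal comprehension $x\in\mathsf{Set}_i$ and $c\in\mathbb{A}_{i-1}$ with $c\#x$, $x@c$ is the unique $X$ with $x=\mathsf{st}([c]X)$. Sigma-action: for $a\in\mathbb{A}_i$, $x\in\mathsf{Set}_i$, the well-defined operation $Z[a\mapsto x]$, $z[a\mapsto x]$ is given by (with $b,c$ atoms distinct from $a$): $\mathsf{and}(\mathcal X)[a\mapsto x]=\mathsf{and}(\{X[a\mapsto x]\mid X\in\mathcal X\})$; $\mathsf{neg}(X)[a\mapsto x]=\mathsf{neg}(X[a\mapsto x])$; $\mathsf{all}([b]X)[a\mapsto x]=\mathsf{all}([b](X[a\mapsto x]))$ if $b\#x$; $\mathsf{elt}(y,a)[a\mapsto\mathsf{atm}(n)]=\mathsf{elt}(y[a\mapsto\mathsf{atm}(n)],n)$ for any $n\in\mathbb{A}_i$; $\mathsf{elt}(y,a)[a\mapsto\mathsf{st}([a']X')]=X'[a'\mapsto y[a\mapsto\mathsf{st}([a']X')]]$ for fresh $a'\in\mathbb{A}_{i-1}$; $\mathsf{elt}(y,b)[a\mapsto x]=\mathsf{elt}(y[a\mapsto x],b)$; $\mathsf{atm}(a)[a\mapsto x]=x$; $\mathsf{atm}(b)[a\mapsto x]=\mathsf{atm}(b)$; $\mathsf{st}([c]X)[a\mapsto x]=\mathsf{st}([c](X[a\mapsto x]))$ if $c\#x$. For $x\in\mathsf{Set}_i$, $y\in\mathsf{Set}_{i-1}$: $y\mathbin{\tilde\in}x=(x@b)[b\mapsto y]$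 for fresh $b\in\mathbb{A}_{i-1}$ if $x$ is a comprehension, and $y\mathbin{\tilde\in}\mathsf{atm}(a)=\mathsf{elt}(y,a)$. Stratified Sets: formulae $\phi::=\bot\mid\neg\phi\mid\phi\wedge\phi\mid\forall a.\phi\mid s\in t$, terms $s::=a\mid\{a\mid\phi\}$, up to $\alpha$-equivalence, with capture-avoiding substitution $\phi[a:=s]$; $\mathrm{level}(\{a\mid\phi\})=\mathrm{level}(a)+1$; stratified means every subformula $s'\in s$ has $\mathrm{level}(s)=\mathrm{level}(s')+1$. Interpretation: $[\![\bot]\!]=\mathsf{neg}(\mathsf{and}(\varnothing))$, $[\![\neg\phi]\!]=\mathsf{neg}([\![\phi]\!])$, $[\![\phi\wedge\psi]\!]=\mathsf{and}(\{[\![\phi]\!],[\![\psi]\!]\})$, $[\![\forall a.\phi]\!]=\mathsf{all}([a][\![\phi]\!])$, $[\![t\in s]\!]=[\![t]\!]\mathbin{\tilde\in}[\![s]\!]$, $[\![\{a\mid\phi\}]\!]=\mathsf{st}([a][\![\phi]\!])$, $[\![a]\!]=\mathsf{atm}(a)$. -}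

module Defs where

open import Data.Integer.Base using (ℤ; pred)
open import Data.List.Base using (List; []; _∷_)
open import Data.Product.Base using (_×_; ∃-syntax)
open import Relation.Binary.PropositionalEquality using (_≡_)

-- Syntax is taken up to α-equivalence (resp. nominal atoms-abstraction)
-- by using well-scoped de Bruijn syntax: a context lists the levels of
-- the atoms in scope, and a variable is a position in the context whose
-- level is the recorded integer.

Ctx : Set
Ctx = List ℤ

data _∋_ : Ctx → ℤ → Set where
  here  : ∀ {Γ i}   → (i ∷ Γ) ∋ i
  there : ∀ {Γ i j} → Γ ∋ i → (j ∷ Γ) ∋ i

Ren : Ctx → Ctx → Set
Ren Γ Δ = ∀ {i} → Γ ∋ i → Δ ∋ i

extR : ∀ {Γ Δ j} → Ren Γ Δ → Ren (j ∷ Γ) (j ∷ Δ)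
extR ρ here      = here
extR ρ (there v) = there (ρ v)

-- Internal syntax  Pred  and  Set_i  (here ISet Γ i).
-- and(𝒳) : the finite set 𝒳 is given by a list; equality of internal
-- syntax is the set-extensional equality _≈P_ below.
-- st([a]X) ∈ Set_i binds a ∈ 𝔸_{i-1};  elt(x,a) with a ∈ 𝔸_i, x ∈ Set_{i-1}.

mutual
  data Pred : Ctx → Set where
    and : ∀ {Γ} → List (Pred Γ) → Pred Γ
    neg : ∀ {Γ} → Pred Γ → Pred Γ
    all : ∀ {Γ} (j : ℤ) → Pred (j ∷ Γ) → Pred Γ
    elt : ∀ {Γ i} → ISet Γ (pred i) → Γ ∋ i → Pred Γ

  data ISet : Ctx → ℤ → Set where
    atm : ∀ {Γ i} → Γ ∋ i → ISet Γ i
    st  : ∀ {Γ i} → Pred (pred i ∷ Γ) → ISet Γ i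

mutual
  renP : ∀ {Γ Δ} → Ren Γ Δ → Pred Γ → Pred Δ
  renP ρ (and Xs)  = and (renL ρ Xs)
  renP ρ (neg X)   = neg (renP ρ X)
  renP ρ (all j X) = all j (renP (extR ρ) X)
  renP ρ (elt y v) = elt (renS ρ y) (ρ v)

  renS : ∀ {Γ Δ i} → Ren Γ Δ → ISet Γ i → ISet Δ i
  renS ρ (atm v) = atm (ρ v)
  renS ρ (st X)  = st (renP (extR ρ) X)

  renL : ∀ {Γ Δ} → Ren Γ Δ → List (Pred Γ) → List (Pred Δ)
  renL ρ []       = []
  renL ρ (X ∷ Xs) = renP ρ X ∷ renL ρ Xs

mutual
  data _≈P_ : ∀ {Γ} → Pred Γ → Pred Γ → Set where
    and : ∀ {Γ} {Xs Ys : List (Pred Γ)} → Xs ⊆≈ Ys → Ys ⊆≈ Xs → and Xs ≈P and Ys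
    neg : ∀ {Γ} {X Y : Pred Γ} → X ≈P Y → neg X ≈P neg Y
    all : ∀ {Γ j} {X Y : Pred (j ∷ Γ)} → X ≈P Y → all j X ≈P all j Y
    elt : ∀ {Γ i} {y y' : ISet Γ (pred i)} {v : Γ ∋ i} → y ≈S y' → elt y v ≈P elt y' v

  data _≈S_ : ∀ {Γ i} → ISet Γ i → ISet Γ i → Set where
    atm : ∀ {Γ i} {v : Γ ∋ i} → atm v ≈S atm v
    st  : ∀ {Γ i} {X Y : Pred (pred i ∷ Γ)} → X ≈P Y → st {Γ} {i} X ≈S st Y

  data _⊆≈_ : ∀ {Γ} → List (Pred Γ) → List (Pred Γ) → Set where
    []  : ∀ {Γ} {Ys : List (Pred Γ)} → [] ⊆≈ Ys
    _∷_ : ∀ {Γ} {X : Pred Γ} {Xs Ys} → X ∈≈ Ys → Xs ⊆≈ Ys → (X ∷ Xs) ⊆≈ Ys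

  data _∈≈_ : ∀ {Γ} → Pred Γ → List (Pred Γ) → Set where
    here  : ∀ {Γ} {X Y : Pred Γ} {Ys} → X ≈P Y → X ∈≈ (Y ∷ Ys)
    there : ∀ {Γ} {X Y : Pred Γ} {Ys} → X ∈≈ Ys → X ∈≈ (Y ∷ Ys)

-- The paper's operation Z[a↦x] is defined by the
-- (non-structural) equations of the context; we define its graph
-- inductively.  It is stated for a (parallel) assignment σ of internal
-- sets to atoms; the single action [a↦x] is  σ = single x
-- (a ↦ x, every other atom b ↦ atm(b)), and going under a binder uses
-- liftσ (the bound atom is fresh for x, mapped to itself).

Sub : Ctx → Ctx → Set
Sub Γ Δ = ∀ {i} → Γ ∋ i → ISet Δ i

liftσ : ∀ {Γ Δ j} → Sub Γ Δ → Sub (j ∷ Γ) (j ∷ Δ)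
liftσ σ here      = atm here
liftσ σ (there v) = renS there (σ v)

single : ∀ {Γ i} → ISet Γ i → Sub (i ∷ Γ) Γ
single x here      = x
single x (there v) = atm v

mutual
  data _⊢P_⇓_ : ∀ {Γ Δ} → Sub Γ Δ → Pred Γ → Pred Δ → Set where
    and : ∀ {Γ Δ} {σ : Sub Γ Δ} {Xs Ys} → σ ⊢L Xs ⇓ Ys → σ ⊢P and Xs ⇓ and Ys
    neg : ∀ {Γ Δ} {σ : Sub Γ Δ} {X Y} → σ ⊢P X ⇓ Y → σ ⊢P neg X ⇓ neg Y
    all : ∀ {Γ Δ j} {σ : Sub Γ Δ} {X Y} → liftσ {j = j} σ ⊢P X ⇓ Y → σ ⊢P all j X ⇓ all j Y
    elt : ∀ {Γ Δ i} {σ : Sub Γ Δ} {y : ISet Γ (pred i)} {v : Γ ∋ i} {y' R} →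
          σ ⊢S y ⇓ y' → y' ~∈ σ v ⇓ R → σ ⊢P elt y v ⇓ R

  data _⊢S_⇓_ : ∀ {Γ Δ i} → Sub Γ Δ → ISet Γ i → ISet Δ i → Set where
    atm : ∀ {Γ Δ i} {σ : Sub Γ Δ} {v : Γ ∋ i} → σ ⊢S atm v ⇓ σ v
    st  : ∀ {Γ Δ i} {σ : Sub Γ Δ} {X : Pred (pred i ∷ Γ)} {Y} →
          liftσ σ ⊢P X ⇓ Y → σ ⊢S st {Γ} {i} X ⇓ st Y

  data _⊢L_⇓_ : ∀ {Γ Δ} → Sub Γ Δ → List (Pred Γ) → List (Pred Δ) → Set where
    []  : ∀ {Γ Δ} {σ : Sub Γ Δ} → σ ⊢L [] ⇓ []
    _∷_ : ∀ {Γ Δ} {σ : Sub Γ Δ} {X Y Xs Ys} → σ ⊢P X ⇓ Y → σ ⊢L Xs ⇓ Ys → σ ⊢L (X ∷ Xs) ⇓ (Y ∷ Ys)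

  data _~∈_⇓_ : ∀ {Γ i} → ISet Γ (pred i) → ISet Γ i → Pred Γ → Set where
    atm : ∀ {Γ i} {y : ISet Γ (pred i)} {v : Γ ∋ i} → y ~∈ atm v ⇓ elt y v
    st  : ∀ {Γ i} {y : ISet Γ (pred i)} {X : Pred (pred i ∷ Γ)} {R} →
          single y ⊢P X ⇓ R → y ~∈ st {Γ} {i} X ⇓ R

-- Z [ a ↦ x ]⇓ R  for the most recently bound atom a (level i) of Z.
_[↦_]⇓_ : ∀ {Γ i} → Pred (i ∷ Γ) → ISet Γ i → Pred Γ → Set
Z [↦ x ]⇓ R = single x ⊢P Z ⇓ R

-- Stratified Sets, up to α-equivalence (de Bruijn), intrinsically
-- stratified: a term carries its level, and  t ∈' s  requires
-- level(s) = level(t) + 1 (written level(t) = pred level(s)).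
-- {a ∣ φ} : Term Γ i  binds a of level pred i.

mutual
  data Form : Ctx → Set where
    ⊥'   : ∀ {Γ} → Form Γ
    ¬'_  : ∀ {Γ} → Form Γ → Form Γ
    _∧'_ : ∀ {Γ} → Form Γ → Form Γ → Form Γ
    ∀'   : ∀ {Γ} (j : ℤ) → Form (j ∷ Γ) → Form Γ
    _∈'_ : ∀ {Γ i} → Term Γ (pred i) → Term Γ i → Form Γ

  data Term : Ctx → ℤ → Set where
    var : ∀ {Γ i} → Γ ∋ i → Term Γ i
    cmp : ∀ {Γ i} → Form (pred i ∷ Γ) → Term Γ i

mutual
  renF : ∀ {Γ Δ} → Ren Γ Δ → Form Γ → Form Δ
  renF ρ ⊥'        = ⊥'
  renF ρ (¬' φ)    = ¬' renF ρ φ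
  renF ρ (φ ∧' ψ)  = renF ρ φ ∧' renF ρ ψ
  renF ρ (∀' j φ)  = ∀' j (renF (extR ρ) φ)
  renF ρ (t ∈' s)  = renT ρ t ∈' renT ρ s

  renT : ∀ {Γ Δ i} → Ren Γ Δ → Term Γ i → Term Δ i
  renT ρ (var v) = var (ρ v)
  renT ρ (cmp φ) = cmp (renF (extR ρ) φ)

ESub : Ctx → Ctx → Set
ESub Γ Δ = ∀ {i} → Γ ∋ i → Term Δ i

liftE : ∀ {Γ Δ j} → ESub Γ Δ → ESub (j ∷ Γ) (j ∷ Δ)
liftE τ here      = var here
liftE τ (there v) = renT there (τ v)

mutual
  substF : ∀ {Γ Δ} → ESub Γ Δ → Form Γ → Form Δ
  substF τ ⊥'       = ⊥'
  substF τ (¬' φ)   = ¬' substF τ φ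
  substF τ (φ ∧' ψ) = substF τ φ ∧' substF τ ψ
  substF τ (∀' j φ) = ∀' j (substF (liftE τ) φ)
  substF τ (t ∈' s) = substT τ t ∈' substT τ s

  substT : ∀ {Γ Δ i} → ESub Γ Δ → Term Γ i → Term Δ i
  substT τ (var v) = τ v
  substT τ (cmp φ) = cmp (substF (liftE τ) φ)

singleE : ∀ {Γ i} → Term Γ i → ESub (i ∷ Γ) Γ
singleE s here      = s
singleE s (there v) = var v

-- φ[a:=s] for the most recently bound atom a of φ
_[:=_] : ∀ {Γ i} → Form (i ∷ Γ) → Term Γ i → Form Γ
φ [:= s ] = substF (singleE s) φ

mutual
  data ⟦_⟧F⇓_ : ∀ {Γ} → Form Γ → Pred Γ → Set where
    ⊥'  : ∀ {Γ} → ⟦ ⊥' {Γ} ⟧F⇓ neg (and [])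
    ¬'_ : ∀ {Γ} {φ : Form Γ} {X} → ⟦ φ ⟧F⇓ X → ⟦ ¬' φ ⟧F⇓ neg X
    _∧'_ : ∀ {Γ} {φ ψ : Form Γ} {X Y} → ⟦ φ ⟧F⇓ X → ⟦ ψ ⟧F⇓ Y →
           ⟦ φ ∧' ψ ⟧F⇓ and (X ∷ Y ∷ [])
    ∀'  : ∀ {Γ j} {φ : Form (j ∷ Γ)} {X} → ⟦ φ ⟧F⇓ X → ⟦ ∀' j φ ⟧F⇓ all j X
    _∈'_ : ∀ {Γ i} {t : Term Γ (pred i)} {s : Term Γ i} {y x R} →
           ⟦ t ⟧T⇓ y → ⟦ s ⟧T⇓ x → y ~∈ x ⇓ R → ⟦ t ∈' s ⟧F⇓ R

  data ⟦_⟧T⇓_ : ∀ {Γ i} → Term Γ i → ISet Γ i → Set where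
    var : ∀ {Γ i} {v : Γ ∋ i} → ⟦ var v ⟧T⇓ atm v
    cmp : ∀ {Γ i} {φ : Form (pred i ∷ Γ)} {X} → ⟦ φ ⟧F⇓ X → ⟦ cmp {Γ} {i} φ ⟧T⇓ st X

-- Two (partially defined) denotations are equal: whatever one side
-- evaluates to, the other evaluates to an equal internal predicate.
-- (All graphs above are deterministic, so this is equality of values.)

_≋_ : ∀ {Γ} → (Pred Γ → Set) → (Pred Γ → Set) → Set
D ≋ E = (∀ X → D X → ∃[ Y ] (E Y × X ≈P Y)) × (∀ Y → E Y → ∃[ X ] (D X × X ≈P Y))

module Submission where

-- Part (2) holds by inspection: the only way to interpret  s ∈ {a ∣ φ}  is
-- to interpret φ as X and s as x and to apply the sigma-action X[a ↦ x].
-- Part (1) then reduces to the substitution lemma  ⟦φ⟧[a ↦ ⟦s⟧] = ⟦φ[a:=s]⟧,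
-- proved for parallel substitutions τ together with their denotation σ.
-- Its only non-structural case is membership, which needs
-- (y ~∈ w)[σ] = y[σ] ~∈ w[σ]; for a comprehension w this is an instance of
-- the composition law  X[σ₁][σ₂] = X[σ₁ ; σ₂]  of sigma-actions, and the two
-- are proved by mutual recursion.  Neither this recursion nor totality of
-- the sigma-action is structural: unfolding  elt(y,a)[a ↦ st X']  continues
-- with a substitution one level lower.  Levels are integers, so we fix a
-- floor m strictly below every comprehension level in sight, show that the
-- sigma-action respects the floor, and measure a substitution by how far
-- its comprehensions rise above m.

open import Defs
open import Data.Integer.Base using (ℤ; pred)
open import Data.Product.Base using (_×_; ∃-syntax)
open import Data.List.Base using (List; _∷_)

open import Data.Integer.Base using (+_; _+_; _-_; -_; ∣_∣; _≤_; _<_; _⊓_; 0ℤ; -[1+_]; -≤+)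
open import Data.Integer.Properties
  using (<⇒≱; +-identityʳ; +-identityˡ; +-pred; pred-mono; ≤-refl; ≤-trans; +-monoʳ-≤;
         +-comm; +-assoc; +-inverseʳ; i⊓j≤i; i⊓j≤j; i≤pred[j]⇒i<j)
open import Data.Nat.Base as ℕ using (ℕ; zero; suc; s≤s)
import Data.Nat.Properties as ℕ
open import Data.List.Base using ([])
open import Data.Product.Base using (_,_; proj₁; proj₂)
open import Data.Unit.Base using (⊤; tt)
open import Data.Empty using (⊥-elim)
open import Function.Bundles using (_⇔_; mk⇔; Equivalence)
open import Relation.Nullary using (¬_)
open import Relation.Binary.PropositionalEquality

variable
  Γ Δ Θ Γ' Δ' : Ctx
  i j : ℤ

-- Level arithmetic relative to a floor m.  A level i has "height n" over
-- m when i ≤ m + n; every level has some height, and a level strictly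
-- above the floor has positive height.

height-positive : ∀ {m i : ℤ} → m < i → ¬ (i ≤ m + + 0)
height-positive {m} {i} m<i le = <⇒≱ m<i (subst (i ≤_) (+-identityʳ m) le)

height-pred : ∀ {m i : ℤ} (n : ℕ) → i ≤ m + + suc n → pred i ≤ m + + n
height-pred {m} {i} n le = subst (pred i ≤_) (sym (+-pred m (+ suc n))) (pred-mono le)

height-exists : ∀ (m i : ℤ) → ∃[ n ] (i ≤ m + + n)
height-exists m i = ∣ i - m ∣ , subst (_≤ m + + ∣ i - m ∣) m+[i-m]≡i (+-monoʳ-≤ m (≤-abs (i - m)))
  where
  ≤-abs : ∀ x → x ≤ + ∣ x ∣
  ≤-abs (+ n)    = ≤-refl
  ≤-abs -[1+ n ] = -≤+

  m+[i-m]≡i : m + (i - m) ≡ i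
  m+[i-m]≡i = begin
    m + (i + - m)   ≡⟨ cong (λ z → m + z) (+-comm i (- m)) ⟩
    m + (- m + i)   ≡⟨ sym (+-assoc m (- m) i) ⟩
    (m + - m) + i   ≡⟨ cong (λ z → z + i) (+-inverseʳ m) ⟩
    0ℤ + i          ≡⟨ +-identityˡ i ⟩
    i               ∎
    where open ≡-Reasoning

⊆≈-there : {Xs Ys : List (Pred Γ)} {Y : Pred Γ} → Xs ⊆≈ Ys → Xs ⊆≈ (Y ∷ Ys)
⊆≈-there []       = []
⊆≈-there (p ∷ ps) = there p ∷ ⊆≈-there ps

mutual
  ≈P-refl : (X : Pred Γ) → X ≈P X
  ≈P-refl (and Xs)  = and (⊆≈-refl Xs) (⊆≈-refl Xs)
  ≈P-refl (neg X)   = neg (≈P-refl X)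
  ≈P-refl (all j X) = all (≈P-refl X)
  ≈P-refl (elt y v) = elt (≈S-refl y)

  ≈S-refl : (x : ISet Γ i) → x ≈S x
  ≈S-refl (atm v) = atm
  ≈S-refl (st X)  = st (≈P-refl X)

  ⊆≈-refl : (Xs : List (Pred Γ)) → Xs ⊆≈ Xs
  ⊆≈-refl []       = []
  ⊆≈-refl (X ∷ Xs) = here (≈P-refl X) ∷ ⊆≈-there (⊆≈-refl Xs)

_∘R_≗_ : Ren Δ Θ → Ren Γ Δ → Ren Γ Θ → Set
_∘R_≗_ {Γ = Γ} ρ ρ' ρ'' = ∀ {i} (v : Γ ∋ i) → ρ (ρ' v) ≡ ρ'' v

∘R-ext : {ρ : Ren Δ Θ} {ρ' : Ren Γ Δ} {ρ'' : Ren Γ Θ} →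
  ρ ∘R ρ' ≗ ρ'' → extR {j = j} ρ ∘R extR ρ' ≗ extR ρ''
∘R-ext h here      = refl
∘R-ext h (there v) = cong there (h v)

mutual
  renP-fusion : {ρ : Ren Δ Θ} {ρ' : Ren Γ Δ} {ρ'' : Ren Γ Θ} →
    ρ ∘R ρ' ≗ ρ'' → (X : Pred Γ) → renP ρ (renP ρ' X) ≡ renP ρ'' X
  renP-fusion h (and Xs)  = cong and (renL-fusion h Xs)
  renP-fusion h (neg X)   = cong neg (renP-fusion h X)
  renP-fusion h (all j X) = cong (all j) (renP-fusion (∘R-ext h) X)
  renP-fusion h (elt y v) = cong₂ elt (renS-fusion h y) (h v)

  renS-fusion : {ρ : Ren Δ Θ} {ρ' : Ren Γ Δ} {ρ'' : Ren Γ Θ} →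
    ρ ∘R ρ' ≗ ρ'' → (x : ISet Γ i) → renS ρ (renS ρ' x) ≡ renS ρ'' x
  renS-fusion h (atm v) = cong atm (h v)
  renS-fusion h (st X)  = cong st (renP-fusion (∘R-ext h) X)

  renL-fusion : {ρ : Ren Δ Θ} {ρ' : Ren Γ Δ} {ρ'' : Ren Γ Θ} →
    ρ ∘R ρ' ≗ ρ'' → (Xs : List (Pred Γ)) → renL ρ (renL ρ' Xs) ≡ renL ρ'' Xs
  renL-fusion h []       = refl
  renL-fusion h (X ∷ Xs) = cong₂ _∷_ (renP-fusion h X) (renL-fusion h Xs)

renS-there-comm : (ρ : Ren Γ Δ) (x : ISet Γ i) →
  renS (there {j = j}) (renS ρ x) ≡ renS (extR ρ) (renS there x)
renS-there-comm ρ x = trans (renS-fusion (λ _ → refl) x) (sym (renS-fusion (λ _ → refl) x))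

Square : Sub Γ Δ → Sub Γ' Δ' → Ren Γ Γ' → Ren Δ Δ' → Set
Square {Γ} σ σ' ρ₁ ρ₂ = ∀ {i} (v : Γ ∋ i) → σ' (ρ₁ v) ≡ renS ρ₂ (σ v)

square-lift : {σ : Sub Γ Δ} {σ' : Sub Γ' Δ'} {ρ₁ : Ren Γ Γ'} {ρ₂ : Ren Δ Δ'} →
  Square σ σ' ρ₁ ρ₂ → Square (liftσ {j = j} σ) (liftσ σ') (extR ρ₁) (extR ρ₂)
square-lift h here = refl
square-lift {σ = σ} {ρ₂ = ρ₂} h (there v) = trans (cong (renS there) (h v)) (renS-there-comm ρ₂ (σ v))

mutual
  σP-ren : {σ : Sub Γ Δ} {σ' : Sub Γ' Δ'} (ρ₁ : Ren Γ Γ') (ρ₂ : Ren Δ Δ') → Square σ σ' ρ₁ ρ₂ →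
    {X : Pred Γ} {R : Pred Δ} → σ ⊢P X ⇓ R → σ' ⊢P renP ρ₁ X ⇓ renP ρ₂ R
  σP-ren ρ₁ ρ₂ h (and d) = and (σL-ren ρ₁ ρ₂ h d)
  σP-ren ρ₁ ρ₂ h (neg d) = neg (σP-ren ρ₁ ρ₂ h d)
  σP-ren ρ₁ ρ₂ h (all d) = all (σP-ren (extR ρ₁) (extR ρ₂) (square-lift h) d)
  σP-ren ρ₁ ρ₂ h (elt {v = v} {y' = y'} {R = R} e mem) =
    elt (σS-ren ρ₁ ρ₂ h e) (subst (λ x → renS ρ₂ y' ~∈ x ⇓ renP ρ₂ R) (sym (h v)) (~∈-ren ρ₂ mem))

  σS-ren : {σ : Sub Γ Δ} {σ' : Sub Γ' Δ'} (ρ₁ : Ren Γ Γ') (ρ₂ : Ren Δ Δ') → Square σ σ' ρ₁ ρ₂ →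
    {x : ISet Γ i} {x' : ISet Δ i} → σ ⊢S x ⇓ x' → σ' ⊢S renS ρ₁ x ⇓ renS ρ₂ x'
  σS-ren {σ' = σ'} ρ₁ ρ₂ h (atm {v = v}) = subst (σ' ⊢S atm (ρ₁ v) ⇓_) (h v) atm
  σS-ren ρ₁ ρ₂ h (st d) = st (σP-ren (extR ρ₁) (extR ρ₂) (square-lift h) d)

  σL-ren : {σ : Sub Γ Δ} {σ' : Sub Γ' Δ'} (ρ₁ : Ren Γ Γ') (ρ₂ : Ren Δ Δ') → Square σ σ' ρ₁ ρ₂ →
    {Xs : List (Pred Γ)} {Rs : List (Pred Δ)} → σ ⊢L Xs ⇓ Rs → σ' ⊢L renL ρ₁ Xs ⇓ renL ρ₂ Rs
  σL-ren ρ₁ ρ₂ h []       = []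
  σL-ren ρ₁ ρ₂ h (d ∷ ds) = σP-ren ρ₁ ρ₂ h d ∷ σL-ren ρ₁ ρ₂ h ds

  ~∈-ren : (ρ : Ren Γ Δ) {y : ISet Γ (pred i)} {x : ISet Γ i} {R : Pred Γ} →
    y ~∈ x ⇓ R → renS ρ y ~∈ renS ρ x ⇓ renP ρ R
  ~∈-ren ρ atm    = atm
  ~∈-ren ρ (st d) = st (σP-ren (extR ρ) ρ (λ { here → refl ; (there v) → refl }) d)

Retracts : Sub Δ Γ → Ren Γ Δ → Set
Retracts {Γ = Γ} σ ρ = ∀ {i} (v : Γ ∋ i) → σ (ρ v) ≡ atm v

retracts-lift : {σ : Sub Δ Γ} {ρ : Ren Γ Δ} → Retracts σ ρ → Retracts (liftσ {j = j} σ) (extR ρ)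
retracts-lift h here      = refl
retracts-lift h (there v) = cong (renS there) (h v)

mutual
  σP-retract : {σ : Sub Δ Γ} {ρ : Ren Γ Δ} → Retracts σ ρ → (X : Pred Γ) → σ ⊢P renP ρ X ⇓ X
  σP-retract h (and Xs)  = and (σL-retract h Xs)
  σP-retract h (neg X)   = neg (σP-retract h X)
  σP-retract h (all j X) = all (σP-retract (retracts-lift h) X)
  σP-retract h (elt y v) = elt (σS-retract h y) (subst (λ x → y ~∈ x ⇓ elt y v) (sym (h v)) atm)

  σS-retract : {σ : Sub Δ Γ} {ρ : Ren Γ Δ} → Retracts σ ρ → (x : ISet Γ i) → σ ⊢S renS ρ x ⇓ x
  σS-retract {σ = σ} {ρ} h (atm v) = subst (σ ⊢S atm (ρ v) ⇓_) (h v) atm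
  σS-retract h (st X) = st (σP-retract (retracts-lift h) X)

  σL-retract : {σ : Sub Δ Γ} {ρ : Ren Γ Δ} → Retracts σ ρ → (Xs : List (Pred Γ)) → σ ⊢L renL ρ Xs ⇓ Xs
  σL-retract h []       = []
  σL-retract h (X ∷ Xs) = σP-retract h X ∷ σL-retract h Xs

mutual
  σP-det : {σ : Sub Γ Δ} {X : Pred Γ} {R R' : Pred Δ} → σ ⊢P X ⇓ R → σ ⊢P X ⇓ R' → R ≡ R'
  σP-det (and d)   (and d')   = cong and (σL-det d d')
  σP-det (neg d)   (neg d')   = cong neg (σP-det d d')
  σP-det (all d)   (all d')   = cong (all _) (σP-det d d')
  σP-det (elt e mem) (elt e' mem') with σS-det e e'
  ... | refl = ~∈-det mem mem'

  σS-det : {σ : Sub Γ Δ} {x : ISet Γ i} {R R' : ISet Δ i} → σ ⊢S x ⇓ R → σ ⊢S x ⇓ R' → R ≡ R'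
  σS-det atm    atm     = refl
  σS-det (st d) (st d') = cong st (σP-det d d')

  σL-det : {σ : Sub Γ Δ} {X : List (Pred Γ)} {R R' : List (Pred Δ)} → σ ⊢L X ⇓ R → σ ⊢L X ⇓ R' → R ≡ R'
  σL-det []       []         = refl
  σL-det (d ∷ ds) (d' ∷ ds') = cong₂ _∷_ (σP-det d d') (σL-det ds ds')

  ~∈-det : {y : ISet Γ (pred i)} {x : ISet Γ i} {R R' : Pred Γ} → y ~∈ x ⇓ R → y ~∈ x ⇓ R' → R ≡ R'
  ~∈-det atm    atm     = refl
  ~∈-det (st d) (st d') = σP-det d d'

mutual
  ⟦⟧F-det : {φ : Form Γ} {X X' : Pred Γ} → ⟦ φ ⟧F⇓ X → ⟦ φ ⟧F⇓ X' → X ≡ X'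
  ⟦⟧F-det ⊥'          ⊥'            = refl
  ⟦⟧F-det (¬' d)      (¬' d')       = cong neg (⟦⟧F-det d d')
  ⟦⟧F-det (d₁ ∧' d₂)  (d₁' ∧' d₂')  = cong₂ (λ X Y → and (X ∷ Y ∷ [])) (⟦⟧F-det d₁ d₁') (⟦⟧F-det d₂ d₂')
  ⟦⟧F-det (∀' d)      (∀' d')       = cong (all _) (⟦⟧F-det d d')
  ⟦⟧F-det (_∈'_ dt ds mem) (_∈'_ dt' ds' mem') with ⟦⟧T-det dt dt' | ⟦⟧T-det ds ds'
  ... | refl | refl = ~∈-det mem mem'

  ⟦⟧T-det : {t : Term Γ i} {x x' : ISet Γ i} → ⟦ t ⟧T⇓ x → ⟦ t ⟧T⇓ x' → x ≡ x'
  ⟦⟧T-det var     var      = refl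
  ⟦⟧T-det (cmp d) (cmp d') = cong st (⟦⟧F-det d d')

mutual
  ⟦⟧F-ren : (ρ : Ren Γ Δ) {φ : Form Γ} {X : Pred Γ} → ⟦ φ ⟧F⇓ X → ⟦ renF ρ φ ⟧F⇓ renP ρ X
  ⟦⟧F-ren ρ ⊥'             = ⊥'
  ⟦⟧F-ren ρ (¬' d)         = ¬' ⟦⟧F-ren ρ d
  ⟦⟧F-ren ρ (d ∧' d')      = ⟦⟧F-ren ρ d ∧' ⟦⟧F-ren ρ d'
  ⟦⟧F-ren ρ (∀' d)         = ∀' (⟦⟧F-ren (extR ρ) d)
  ⟦⟧F-ren ρ (_∈'_ dt ds mem) = _∈'_ (⟦⟧T-ren ρ dt) (⟦⟧T-ren ρ ds) (~∈-ren ρ mem)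

  ⟦⟧T-ren : (ρ : Ren Γ Δ) {t : Term Γ i} {x : ISet Γ i} → ⟦ t ⟧T⇓ x → ⟦ renT ρ t ⟧T⇓ renS ρ x
  ⟦⟧T-ren ρ var     = var
  ⟦⟧T-ren ρ (cmp d) = cmp (⟦⟧F-ren (extR ρ) d)

cons : ISet Δ i → Sub Γ Δ → Sub (i ∷ Γ) Δ
cons y σ here      = y
cons y σ (there v) = σ v

Composite : Sub Γ Δ → Sub Δ Θ → Sub Γ Θ → Set
Composite {Γ} σ₁ σ₂ θ = ∀ {i} (v : Γ ∋ i) → σ₂ ⊢S σ₁ v ⇓ θ v

composite-lift : {σ₁ : Sub Γ Δ} {σ₂ : Sub Δ Θ} {θ : Sub Γ Θ} → Composite σ₁ σ₂ θ →
  Composite (liftσ {j = j} σ₁) (liftσ σ₂) (liftσ θ)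
composite-lift c here      = atm
composite-lift c (there v) = σS-ren there there (λ _ → refl) (c v)

Denotes : ESub Γ Δ → Sub Γ Δ → Set
Denotes {Γ} τ σ = ∀ {i} (v : Γ ∋ i) → ⟦ τ v ⟧T⇓ σ v

denotes-lift : {τ : ESub Γ Δ} {σ : Sub Γ Δ} → Denotes τ σ → Denotes (liftE {j = j} τ) (liftσ σ)
denotes-lift r here      = var
denotes-lift r (there v) = ⟦⟧T-ren there (r v)

denotes-single : {s : Term Γ i} {x : ISet Γ i} → ⟦ s ⟧T⇓ x → Denotes (singleE s) (single x)
denotes-single ds here      = ds
denotes-single ds (there v) = var

module Floored (m : ℤ) where

  mutual
    AboveP : Pred Γ → Set
    AboveP (and Xs)  = AboveL Xs
    AboveP (neg X)   = AboveP X
    AboveP (all j X) = AboveP X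
    AboveP (elt y v) = AboveS y

    AboveS : ISet Γ i → Set
    AboveS (atm v)          = ⊤
    AboveS (st {i = i} X)   = (m < i) × AboveP X

    AboveL : List (Pred Γ) → Set
    AboveL []       = ⊤
    AboveL (X ∷ Xs) = AboveP X × AboveL Xs

  mutual
    AboveF : Form Γ → Set
    AboveF ⊥'       = ⊤
    AboveF (¬' φ)   = AboveF φ
    AboveF (φ ∧' ψ) = AboveF φ × AboveF ψ
    AboveF (∀' j φ) = AboveF φ
    AboveF (t ∈' s) = AboveT t × AboveT s

    AboveT : Term Γ i → Set
    AboveT (var v)         = ⊤
    AboveT (cmp {i = i} φ) = (m < i) × AboveF φ

  mutual
    aboveP-ren : (ρ : Ren Γ Δ) (X : Pred Γ) → AboveP X → AboveP (renP ρ X)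
    aboveP-ren ρ (and Xs)  a = aboveL-ren ρ Xs a
    aboveP-ren ρ (neg X)   a = aboveP-ren ρ X a
    aboveP-ren ρ (all j X) a = aboveP-ren (extR ρ) X a
    aboveP-ren ρ (elt y v) a = aboveS-ren ρ y a

    aboveS-ren : (ρ : Ren Γ Δ) (x : ISet Γ i) → AboveS x → AboveS (renS ρ x)
    aboveS-ren ρ (atm v) a       = tt
    aboveS-ren ρ (st X)  (p , a) = p , aboveP-ren (extR ρ) X a

    aboveL-ren : (ρ : Ren Γ Δ) (Xs : List (Pred Γ)) → AboveL Xs → AboveL (renL ρ Xs)
    aboveL-ren ρ []       a        = tt
    aboveL-ren ρ (X ∷ Xs) (a , as) = aboveP-ren ρ X a , aboveL-ren ρ Xs as

  Within : ℕ → ISet Γ i → Set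
  Within n (atm v)        = ⊤
  Within n (st {i = i} X) = i ≤ m + + n

  within-ren : ∀ {n} (ρ : Ren Γ Δ) (x : ISet Γ i) → Within n x → Within n (renS ρ x)
  within-ren ρ (atm v) _ = tt
  within-ren ρ (st X)  p = p

  within-level : ∀ {n} (x : ISet Γ i) → i ≤ m + + n → Within n x
  within-level (atm v) _ = tt
  within-level (st X)  p = p

  within-exists : (x : ISet Γ i) → ∃[ n ] Within n x
  within-exists (atm v)        = 0 , tt
  within-exists (st {i = i} X) = height-exists m i

  Admissible : ℕ → Sub Γ Δ → Set
  Admissible {Γ} n σ = ∀ {i} (v : Γ ∋ i) → AboveS (σ v) × Within n (σ v)

  admissible-lift : ∀ {n} {σ : Sub Γ Δ} → Admissible n σ → Admissible n (liftσ {j = j} σ)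
  admissible-lift g here      = tt , tt
  admissible-lift {σ = σ} g (there v) =
    aboveS-ren there (σ v) (proj₁ (g v)) , within-ren there (σ v) (proj₂ (g v))

  admissible-single : ∀ {n} (y : ISet Γ i) → AboveS y → i ≤ m + + n → Admissible n (single y)
  admissible-single y a p here      = a , within-level y p
  admissible-single y a p (there v) = tt , tt

  -- Totality: an admissible sigma-action is defined on syntax above the
  -- floor and stays above it.  Unfolding a comprehension of height n + 1
  -- recurses at height n.
  mutual
    σP-total : (n : ℕ) {σ : Sub Γ Δ} → Admissible n σ → (X : Pred Γ) → AboveP X →
      ∃[ R ] (σ ⊢P X ⇓ R × AboveP R)
    σP-total n g (and Xs) a with σL-total n g Xs a
    ... | Ys , d , a' = and Ys , and d , a'
    σP-total n g (neg X) a with σP-total n g X a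
    ... | Y , d , a' = neg Y , neg d , a'
    σP-total n g (all j X) a with σP-total n (admissible-lift g) X a
    ... | Y , d , a' = all j Y , all d , a'
    σP-total n {σ} g (elt y v) a with σS-total n g y a
    ... | y' , e , a' with ~∈-total n y' a' (σ v) (proj₁ (g v)) (proj₂ (g v))
    ... | R , r , aR = R , elt e r , aR

    σS-total : (n : ℕ) {σ : Sub Γ Δ} → Admissible n σ → (x : ISet Γ i) → AboveS x →
      ∃[ R ] (σ ⊢S x ⇓ R × AboveS R)
    σS-total n {σ} g (atm v) a = σ v , atm , proj₁ (g v)
    σS-total n g (st X) (p , a) with σP-total n (admissible-lift g) X a
    ... | Y , d , a' = st Y , st d , (p , a')

    σL-total : (n : ℕ) {σ : Sub Γ Δ} → Admissible n σ → (Xs : List (Pred Γ)) → AboveL Xs →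
      ∃[ R ] (σ ⊢L Xs ⇓ R × AboveL R)
    σL-total n g [] a = [] , [] , tt
    σL-total n g (X ∷ Xs) (a , as) with σP-total n g X a | σL-total n g Xs as
    ... | Y , d , a' | Ys , ds , as' = Y ∷ Ys , d ∷ ds , (a' , as')

    ~∈-total : (n : ℕ) (y : ISet Δ (pred i)) → AboveS y → (x : ISet Δ i) → AboveS x → Within n x →
      ∃[ R ] (y ~∈ x ⇓ R × AboveP R)
    ~∈-total n y ay (atm w) _ _ = elt y w , atm , ay
    ~∈-total zero y ay (st X) (p , aX) h = ⊥-elim (height-positive p h)
    ~∈-total (suc n) y ay (st X) (p , aX) h with σP-total n (admissible-single y ay (height-pred {m = m} n h)) X aX
    ... | R , d , aR = R , st d , aR

  σP-above : ∀ {n} {σ : Sub Γ Δ} {X R} → Admissible n σ → AboveP X → σ ⊢P X ⇓ R → AboveP R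
  σP-above {n = n} g a d with σP-total n g _ a
  ... | R' , d' , a' = subst AboveP (σP-det d' d) a'

  σS-above : ∀ {n} {σ : Sub Γ Δ} {x : ISet Γ i} {R} → Admissible n σ → AboveS x → σ ⊢S x ⇓ R → AboveS R
  σS-above {n = n} g a d with σS-total n g _ a
  ... | R' , d' , a' = subst AboveS (σS-det d' d) a'

  -- For σ₁, σ₂ admissible at heights a, b the
  -- recursion is on the fuel k ≥ a + b: unfolding a comprehension of height
  -- a + 1 leads to two compositions whose heights sum to a + b.
  mutual
    σP-comp : ∀ (k : ℕ) {a b : ℕ} {σ₁ : Sub Γ Δ} {σ₂ : Sub Δ Θ} {θ : Sub Γ Θ} {X Y R} →
      Admissible a σ₁ → Admissible b σ₂ → a ℕ.+ b ℕ.≤ k → Composite σ₁ σ₂ θ → AboveP X →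
      σ₁ ⊢P X ⇓ Y → σ₂ ⊢P Y ⇓ R → θ ⊢P X ⇓ R
    σP-comp k g₁ g₂ le c aX (and d₁) (and d₂) = and (σL-comp k g₁ g₂ le c aX d₁ d₂)
    σP-comp k g₁ g₂ le c aX (neg d₁) (neg d₂) = neg (σP-comp k g₁ g₂ le c aX d₁ d₂)
    σP-comp k g₁ g₂ le c aX (all d₁) (all d₂) =
      all (σP-comp k (admissible-lift g₁) (admissible-lift g₂) le (composite-lift c) aX d₁ d₂)
    σP-comp k {b = b} {σ₁} g₁ g₂ le c ay (elt {v = v} e₁ r₁) d₂ with σS-total b g₂ _ (σS-above g₁ ay e₁)
    ... | y₂ , e₂ , _ =
      elt (σS-comp k g₁ g₂ le c ay e₁ e₂)
          (~∈-comp k (σ₁ v) (proj₁ (g₁ v)) (proj₂ (g₁ v)) (σS-above g₁ ay e₁) g₂ le r₁ d₂ e₂ (c v))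

    σS-comp : ∀ (k : ℕ) {a b : ℕ} {σ₁ : Sub Γ Δ} {σ₂ : Sub Δ Θ} {θ : Sub Γ Θ} {x : ISet Γ i} {y z} →
      Admissible a σ₁ → Admissible b σ₂ → a ℕ.+ b ℕ.≤ k → Composite σ₁ σ₂ θ → AboveS x →
      σ₁ ⊢S x ⇓ y → σ₂ ⊢S y ⇓ z → θ ⊢S x ⇓ z
    σS-comp k {θ = θ} g₁ g₂ le c ax (atm {v = v}) e₂ = subst (θ ⊢S atm v ⇓_) (σS-det (c v) e₂) atm
    σS-comp k g₁ g₂ le c (_ , aX) (st d₁) (st d₂) =
      st (σP-comp k (admissible-lift g₁) (admissible-lift g₂) le (composite-lift c) aX d₁ d₂)

    σL-comp : ∀ (k : ℕ) {a b : ℕ} {σ₁ : Sub Γ Δ} {σ₂ : Sub Δ Θ} {θ : Sub Γ Θ} {Xs Ys Rs} →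
      Admissible a σ₁ → Admissible b σ₂ → a ℕ.+ b ℕ.≤ k → Composite σ₁ σ₂ θ → AboveL Xs →
      σ₁ ⊢L Xs ⇓ Ys → σ₂ ⊢L Ys ⇓ Rs → θ ⊢L Xs ⇓ Rs
    σL-comp k g₁ g₂ le c aXs [] [] = []
    σL-comp k g₁ g₂ le c (aX , aXs) (d₁ ∷ ds₁) (d₂ ∷ ds₂) =
      σP-comp k g₁ g₂ le c aX d₁ d₂ ∷ σL-comp k g₁ g₂ le c aXs ds₁ ds₂

    ~∈-comp : ∀ (k : ℕ) {a b : ℕ} {σ : Sub Γ Δ} {y : ISet Γ (pred i)} {y' w' X R} (w : ISet Γ i) →
      AboveS w → Within a w → AboveS y → Admissible b σ → a ℕ.+ b ℕ.≤ k →
      y ~∈ w ⇓ X → σ ⊢P X ⇓ R → σ ⊢S y ⇓ y' → σ ⊢S w ⇓ w' → y' ~∈ w' ⇓ R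
    ~∈-comp k (atm v) _ _ _ g le atm (elt e r) ey atm with σS-det e ey
    ... | refl = r
    ~∈-comp k {zero} (st W) (p , aW) h ay g le (st D₁) d ey (st dW) = ⊥-elim (height-positive p h)
    ~∈-comp k {suc a} (st W) (p , aW) h ay g le (st D₁) d ey (st dW) =
      ~∈st-comp k a _ W aW (height-pred {m = m} a h) ay g le D₁ d ey dW

    -- The comprehension case:  W[a ↦ y][σ] = W[cons y[σ] σ] = W[lift σ][a ↦ y[σ]].
    ~∈st-comp : ∀ (k a b : ℕ) {i : ℤ} {σ : Sub Γ Δ} {y : ISet Γ (pred i)} {y' : ISet Δ (pred i)} {W' X R}
      (W : Pred (pred i ∷ Γ)) → AboveP W → pred i ≤ m + + a → AboveS y → Admissible b σ →
      suc a ℕ.+ b ℕ.≤ k →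
      single y ⊢P W ⇓ X → σ ⊢P X ⇓ R → σ ⊢S y ⇓ y' → liftσ σ ⊢P W ⇓ W' → y' ~∈ st {i = i} W' ⇓ R
    ~∈st-comp zero a b W aW h ay g () D₁ d ey dW
    ~∈st-comp (suc k) a b {i} {σ} {y} {y'} {W'} W aW h ay g (s≤s le) D₁ d ey dW =
      st {i = i} (subst (single y' ⊢P W' ⇓_) (sym (σP-det via-single via-lift)) d')
      where
      g' : Admissible a (single y')
      g' = admissible-single y' (σS-above g ay ey) h

      d' : single y' ⊢P W' ⇓ proj₁ (σP-total a g' W' (σP-above (admissible-lift g) aW dW))
      d' = proj₁ (proj₂ (σP-total a g' W' (σP-above (admissible-lift g) aW dW)))

      single-then-σ : Composite (single y) σ (cons y' σ)
      single-then-σ here      = ey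
      single-then-σ (there u) = atm

      lift-then-single : Composite (liftσ σ) (single y') (cons y' σ)
      lift-then-single here      = atm
      lift-then-single (there u) = σS-retract (λ _ → refl) (σ u)

      via-single = σP-comp k (admissible-single y ay h) g le single-then-σ aW D₁ d
      via-lift   = σP-comp k (admissible-lift g) g' (subst (ℕ._≤ k) (ℕ.+-comm a b) le)
                     lift-then-single aW dW d'

  ~∈-above : {y : ISet Γ (pred i)} {x : ISet Γ i} {R : Pred Γ} → AboveS y → AboveS x → y ~∈ x ⇓ R → AboveP R
  ~∈-above ay ax atm = ay
  ~∈-above {i = i} {y = y} ay (p , aX) (st d) with height-exists m (pred i)
  ... | n , h = σP-above (admissible-single y ay h) aX d

  mutual
    ⟦⟧F-above : {φ : Form Γ} {X : Pred Γ} → AboveF φ → ⟦ φ ⟧F⇓ X → AboveP X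
    ⟦⟧F-above a ⊥'                       = tt
    ⟦⟧F-above a (¬' d)                   = ⟦⟧F-above a d
    ⟦⟧F-above (a₁ , a₂) (d₁ ∧' d₂)       = ⟦⟧F-above a₁ d₁ , (⟦⟧F-above a₂ d₂ , tt)
    ⟦⟧F-above a (∀' d)                   = ⟦⟧F-above a d
    ⟦⟧F-above (at , as) (_∈'_ dt ds r)   = ~∈-above (⟦⟧T-above at dt) (⟦⟧T-above as ds) r

    ⟦⟧T-above : {t : Term Γ i} {x : ISet Γ i} → AboveT t → ⟦ t ⟧T⇓ x → AboveS x
    ⟦⟧T-above a       var     = tt
    ⟦⟧T-above (p , a) (cmp d) = p , ⟦⟧F-above a d

  mutual
    ⟦⟧F-total : (φ : Form Γ) → AboveF φ → ∃[ X ] ⟦ φ ⟧F⇓ X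
    ⟦⟧F-total ⊥' a = _ , ⊥'
    ⟦⟧F-total (¬' φ) a with ⟦⟧F-total φ a
    ... | X , d = _ , ¬' d
    ⟦⟧F-total (φ ∧' ψ) (a₁ , a₂) with ⟦⟧F-total φ a₁ | ⟦⟧F-total ψ a₂
    ... | X , d | Y , e = _ , (d ∧' e)
    ⟦⟧F-total (∀' j φ) a with ⟦⟧F-total φ a
    ... | X , d = _ , ∀' d
    ⟦⟧F-total (t ∈' s) (at , as) with ⟦⟧T-total t at | ⟦⟧T-total s as
    ... | y , dt | x , ds with within-exists x
    ... | n , h with ~∈-total n y (⟦⟧T-above at dt) x (⟦⟧T-above as ds) h
    ... | R , r , _ = R , _∈'_ dt ds r

    ⟦⟧T-total : (t : Term Γ i) → AboveT t → ∃[ x ] ⟦ t ⟧T⇓ x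
    ⟦⟧T-total (var v) a = _ , var
    ⟦⟧T-total (cmp φ) (p , a) with ⟦⟧F-total φ a
    ... | X , d = _ , cmp d

  mutual
    ⟦⟧F-subst : ∀ {b} {σ : Sub Γ Δ} {τ : ESub Γ Δ} {φ : Form Γ} {X R} →
      Admissible b σ → Denotes τ σ → AboveF φ → ⟦ φ ⟧F⇓ X → σ ⊢P X ⇓ R → ⟦ substF τ φ ⟧F⇓ R
    ⟦⟧F-subst g r a ⊥' (neg (and [])) = ⊥'
    ⟦⟧F-subst g r a (¬' d) (neg e) = ¬' ⟦⟧F-subst g r a d e
    ⟦⟧F-subst g r (a₁ , a₂) (d₁ ∧' d₂) (and (e₁ ∷ e₂ ∷ [])) = ⟦⟧F-subst g r a₁ d₁ e₁ ∧' ⟦⟧F-subst g r a₂ d₂ e₂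
    ⟦⟧F-subst g r a (∀' d) (all e) = ∀' (⟦⟧F-subst (admissible-lift g) (denotes-lift r) a d e)
    ⟦⟧F-subst {b = b} g r (at , as) (_∈'_ {y = y} {x = w} dt ds mem) e
      with σS-total b g y (⟦⟧T-above at dt) | σS-total b g w (⟦⟧T-above as ds) | within-exists w
    ... | y' , ey , _ | w' , ew , _ | a , h =
      _∈'_ (⟦⟧T-subst g r at dt ey) (⟦⟧T-subst g r as ds ew)
           (~∈-comp (a ℕ.+ b) w (⟦⟧T-above as ds) h (⟦⟧T-above at dt) g ℕ.≤-refl mem e ey ew)

    ⟦⟧T-subst : ∀ {b} {σ : Sub Γ Δ} {τ : ESub Γ Δ} {t : Term Γ i} {x x'} →
      Admissible b σ → Denotes τ σ → AboveT t → ⟦ t ⟧T⇓ x → σ ⊢S x ⇓ x' → ⟦ substT τ t ⟧T⇓ x'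
    ⟦⟧T-subst g r a (var {v = v}) atm = r v
    ⟦⟧T-subst g r (_ , a) (cmp d) (st e) = cmp (⟦⟧F-subst (admissible-lift g) (denotes-lift r) a d e)

mutual
  floorF : Form Γ → ℤ
  floorF ⊥'       = 0ℤ
  floorF (¬' φ)   = floorF φ
  floorF (φ ∧' ψ) = floorF φ ⊓ floorF ψ
  floorF (∀' j φ) = floorF φ
  floorF (t ∈' s) = floorT t ⊓ floorT s

  floorT : Term Γ i → ℤ
  floorT (var v)         = 0ℤ
  floorT (cmp {i = i} φ) = pred i ⊓ floorF φ

mutual
  aboveF-floor : (m : ℤ) (φ : Form Γ) → m ≤ floorF φ → Floored.AboveF m φ
  aboveF-floor m ⊥'       p = tt
  aboveF-floor m (¬' φ)   p = aboveF-floor m φ p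
  aboveF-floor m (φ ∧' ψ) p = aboveF-floor m φ (≤-trans p (i⊓j≤i _ _)) , aboveF-floor m ψ (≤-trans p (i⊓j≤j _ _))
  aboveF-floor m (∀' j φ) p = aboveF-floor m φ p
  aboveF-floor m (t ∈' s) p = aboveT-floor m t (≤-trans p (i⊓j≤i _ _)) , aboveT-floor m s (≤-trans p (i⊓j≤j _ _))

  aboveT-floor : (m : ℤ) (t : Term Γ i) → m ≤ floorT t → Floored.AboveT m t
  aboveT-floor m (var v) p = tt
  aboveT-floor m (cmp φ) p = i≤pred[j]⇒i<j (≤-trans p (i⊓j≤i _ _)) , aboveF-floor m φ (≤-trans p (i⊓j≤j _ _))

module _ (φ : Form (i ∷ Γ)) (s : Term Γ i) where
  open Floored (floorF φ ⊓ floorT s)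

  private
    aφ : AboveF φ
    aφ = aboveF-floor _ φ (i⊓j≤i _ _)

    as : AboveT s
    as = aboveT-floor _ s (i⊓j≤j _ _)

    admissible-⟦s⟧ : {x : ISet Γ i} → ⟦ s ⟧T⇓ x → Admissible _ (single x)
    admissible-⟦s⟧ {x} ds =
      admissible-single x (⟦⟧T-above as ds) (proj₂ (height-exists (floorF φ ⊓ floorT s) i))

  single-subst : {X : Pred (i ∷ Γ)} {R : Pred Γ} {x : ISet Γ i} →
    ⟦ φ ⟧F⇓ X → ⟦ s ⟧T⇓ x → X [↦ x ]⇓ R → ⟦ φ [:= s ] ⟧F⇓ R
  single-subst dφ ds d = ⟦⟧F-subst (admissible-⟦s⟧ ds) (denotes-single ds) aφ dφ d

  single-total : ∃[ X ] ∃[ x ] ∃[ R ] (⟦ φ ⟧F⇓ X × ⟦ s ⟧T⇓ x × X [↦ x ]⇓ R)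
  single-total with ⟦⟧F-total φ aφ | ⟦⟧T-total s as
  ... | X , dφ | x , ds with σP-total _ (admissible-⟦s⟧ ds) X (⟦⟧F-above aφ dφ)
  ... | R , d , _ = X , x , R , dφ , ds , d

≋-from-⇔ : {D E : Pred Γ → Set} → (∀ R → D R ⇔ E R) → D ≋ E
≋-from-⇔ h = (λ R d → R , Equivalence.to (h R) d , ≈P-refl R)
           , (λ R e → R , Equivalence.from (h R) e , ≈P-refl R)

∈-cmp⇔ : (φ : Form (pred j ∷ Γ)) (s : Term Γ (pred j)) (R : Pred Γ) →
  ⟦ s ∈' cmp {i = j} φ ⟧F⇓ R ⇔ (∃[ X ] ∃[ x ] (⟦ φ ⟧F⇓ X × ⟦ s ⟧T⇓ x × X [↦ x ]⇓ R))
∈-cmp⇔ φ s R = mk⇔ (λ { (_∈'_ ds (cmp dφ) (st d)) → _ , _ , dφ , ds , d })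
                   (λ { (X , x , dφ , ds , d) → _∈'_ ds (cmp dφ) (st d) })

lemma5p13 : ∀ {Γ : Ctx} {j : ℤ} (φ : Form (pred j ∷ Γ)) (s : Term Γ (pred j)) →
    ((⟦ s ∈' cmp {i = j} φ ⟧F⇓_) ≋ (⟦ φ [:= s ] ⟧F⇓_))
    × ((⟦ s ∈' cmp {i = j} φ ⟧F⇓_) ≋ (λ R → ∃[ X ] ∃[ x ] (⟦ φ ⟧F⇓ X × ⟦ s ⟧T⇓ x × X [↦ x ]⇓ R)))
lemma5p13 φ s = ≋-from-⇔ part1 , ≋-from-⇔ (∈-cmp⇔ φ s)
  where
  -- Part (1): via part (2), the substitution lemma, and (for the converse)
  -- totality of the left-hand side plus determinism of the right.
  part1 : ∀ R → ⟦ s ∈' cmp φ ⟧F⇓ R ⇔ ⟦ φ [:= s ] ⟧F⇓ R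
  part1 R = mk⇔ to from
    where
    to : ⟦ s ∈' cmp φ ⟧F⇓ R → ⟦ φ [:= s ] ⟧F⇓ R
    to d with Equivalence.to (∈-cmp⇔ φ s R) d
    ... | X , x , dφ , ds , dσ = single-subst φ s dφ ds dσ

    from : ⟦ φ [:= s ] ⟧F⇓ R → ⟦ s ∈' cmp φ ⟧F⇓ R
    from dR with single-total φ s
    ... | X , x , R' , dφ , ds , dσ with ⟦⟧F-det (single-subst φ s dφ ds dσ) dR
    ... | refl = Equivalence.from (∈-cmp⇔ φ s R) (X , x , dφ , ds , dσ)
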